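{- At the end of the insertion procedure, the new weight becomes the special weight.
   Context: Let $\star$ denote a letter representing a box of the basement. A weighted Dyck word is a word $w$ with letters in $\{\star,U,D\}\cup\mathbb{N}$ such that: (i) $w$ belongs to the language $\left(\star(U+D)\mathbb{N}(U+D)\right)^*\star$; (ii) the subword of $w$ in the letters $D$ and $U$ is a Dyck word (every prefix has at least as many $D$'s as $U$'s, with equality for the whole word); (iii) for each position $i$ with $w(i)\in\mathbb{N}$, $w(i)<ch(i,w)$, where $ch(i,w):=\left\lceil \frac{|\{ j<i \mid w(j)=D \}| - |\{ j<i \mid w(j)=U \}|}{2}\right\rceil$ is the column height. The integer letters are the weights; the size is the number of weights. A weight $w(i)$ is maximal if $w(i)=ch(i,w)-1$; it is eligible if it is maximal and immediately preceded by $D$; the special weight is the right-most eligible weight (it exists and is unique for size $\ge1$). A column addition replaces a letter $\star$ at position $i$ by $\star\, D\, m\, U\, \star$ with $m=ch(i,w)-1$ (the new weight). A ribbon addition on a letter $U$ placed before a letter $D$ exchanges these two letters. The insertion procedure, applied to a weighted Dyck word of size $k\ge0$, is: (1) find the special weight $s$ (skipped if $k=0$); (2) choose a letter $\star$; (3) perform a column addition at the chosen $\star$; (4) if the chosen $\star$ is to the left of $s$, perform a ribbon addition on the $U$ letter following the new weight and the $D$ letter preceding $s$ (skipped if $k=0$). The output is a weighted Dyck word of size $k+1$. -}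

module Defs where

open import Data.Nat using (ℕ; zero; suc; _+_; _∸_; _≤_; _<_; _<?_; ⌈_/2⌉)
open import Relation.Nullary using (yes; no)
open import Data.List using (List; []; _∷_; _++_; take; drop)
open import Data.Maybe using (Maybe; just; nothing)
open import Data.Product using (Σ; _×_; ∃; ∃-syntax)
open import Relation.Binary.PropositionalEquality using (_≡_)

-- Letters: ⋆ (basement box), U, D, and weights (natural numbers).
data Letter : Set where
  ⋆  : Letter
  U  : Letter
  D  : Letter
  wt : ℕ → Letter

Word : Set
Word = List Letter

_!_ : Word → ℕ → Maybe Letter
[]      ! _     = nothing
(x ∷ w) ! zero  = just x
(x ∷ w) ! suc i = w ! i

setAt : Word → ℕ → Letter → Word
setAt []      _       _ = []
setAt (x ∷ w) zero    a = a ∷ w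
setAt (x ∷ w) (suc i) a = x ∷ setAt w i a

countD : Word → ℕ
countD []          = 0
countD (D ∷ w)     = suc (countD w)
countD (_ ∷ w)     = countD w

countU : Word → ℕ
countU []          = 0
countU (U ∷ w)     = suc (countU w)
countU (_ ∷ w)     = countU w

size : Word → ℕ
size []         = 0
size (wt _ ∷ w) = suc (size w)
size (_ ∷ w)    = size w

-- column height ch(i,w) = ⌈ (#D before i − #U before i) / 2 ⌉
-- (the difference is nonnegative on Dyck-valid words, so ∸ is exact there)
ch : ℕ → Word → ℕ
ch i w = ⌈ (countD (take i w) ∸ countU (take i w)) /2⌉

data UD : Letter → Set where
  isU : UD U
  isD : UD D

data Shape : Word → Set where
  end  : Shape (⋆ ∷ [])
  step : ∀ {a b n w} → UD a → UD b → Shape w → Shape (⋆ ∷ a ∷ wt n ∷ b ∷ w)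

-- the U/D subword is a Dyck word (D = up step, U = down step)
IsDyck : Word → Set
IsDyck w = (∀ i → countU (take i w) ≤ countD (take i w)) × (countU w ≡ countD w)

WeightsBounded : Word → Set
WeightsBounded w = ∀ i m → w ! i ≡ just (wt m) → m < ch i w

record WeightedDyck (w : Word) : Set where
  field
    shape   : Shape w
    dyck    : IsDyck w
    bounded : WeightsBounded w

Maximal : Word → ℕ → Set
Maximal w i = ∃[ m ] (w ! i ≡ just (wt m) × suc m ≡ ch i w)

Eligible : Word → ℕ → Set
Eligible w i = Maximal w i × ∃[ j ] (i ≡ suc j × w ! j ≡ just D)

IsSpecial : Word → ℕ → Set
IsSpecial w i = Eligible w i × (∀ j → Eligible w j → j ≤ i)

-- column addition at the ⋆ at position p: ⋆ ↦ ⋆ D m U ⋆, the new weight m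
-- sitting at position p+2 with m = ch(p+2, new word) ∸ 1 (i.e. it is maximal).
newWeight : Word → ℕ → ℕ
newWeight w p = ch (p + 2) (take p w ++ ⋆ ∷ D ∷ []) ∸ 1

columnAdd : Word → ℕ → Word
columnAdd w p = take p w ++ ⋆ ∷ D ∷ wt (newWeight w p) ∷ U ∷ ⋆ ∷ drop (suc p) w

ribbonAdd : Word → ℕ → ℕ → Word
ribbonAdd w i j = setAt (setAt w i D) j U

SpecialOf : Word → Maybe ℕ → Set
SpecialOf w nothing  = size w ≡ 0
SpecialOf w (just s) = IsSpecial w s

-- After the column addition (4 letters inserted before old position p+1),
-- the U following the new weight is at p+3, and the D preceding s is at s+3.
insert : Word → ℕ → Maybe ℕ → Word
insert w p nothing  = columnAdd w p
insert w p (just s) with p <? s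
... | yes _ = ribbonAdd (columnAdd w p) (p + 3) (s + 3)
... | no _  = columnAdd w p

-- Write w = A ⋆ B, the chosen ⋆ following A. The new weight comes right after a D
-- and is maximal by construction, so it is eligible; it remains to see that no
-- eligible weight lies to its right. Without a ribbon addition, the letters right
-- of the new column see the same column heights as in w, so an eligible weight
-- there would be an eligible weight of w right of the chosen ⋆, hence right of the
-- special weight s. With a ribbon addition, B = B₁ D s B₂ becomes B₁ U s B₂ behind
-- two extra letters D: the weights of B₁ gain one unit of column height and so
-- cannot be maximal, s now follows U, and beyond s the heights are those of w
-- again, where nothing right of s is eligible.
module Submission where

open import Data.Nat using (ℕ; zero; suc; _+_; _∸_; _≤_; _<_; _<?_; ⌈_/2⌉; z≤n; s≤s; s≤s⁻¹)
open import Data.Nat.Properties using (+-suc; +-comm; +-identityʳ; +-∸-assoc; +-cancelˡ-≤; m≤m+n; ≤-trans; ≤-reflexive; <-irrefl; <⇒≱; ≮⇒≥; suc-injective)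
open import Data.Nat.Tactic.RingSolver using (solve-∀)
open import Data.List using (List; []; _∷_; _++_; take; drop; length)
open import Data.Maybe using (Maybe; just; nothing)
open import Data.Product using (_×_; _,_; proj₁; ∃-syntax; map)
open import Data.Sum using (_⊎_; inj₁; inj₂)
open import Data.Empty using (⊥-elim)
open import Relation.Nullary using (¬_; yes; no)
open import Relation.Binary.PropositionalEquality using (_≡_; refl; sym; trans; cong; cong₂; subst; subst₂; module ≡-Reasoning)

open import Defs

private
  variable
    A′ : Set
    z : A′
    xs ys : List A′
    x : Letter
    R : Word
    d u i k : ℕ

take-length-++ : take (length xs) (xs ++ ys) ≡ xs
take-length-++ {xs = []}     = refl
take-length-++ {xs = x ∷ xs} = cong (x ∷_) take-length-++

take-length+-++ : ∀ xs → take (length xs + k) (xs ++ ys) ≡ xs ++ take k ys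
take-length+-++ []       = refl
take-length+-++ (x ∷ xs) = cong (x ∷_) (take-length+-++ xs)

drop-suc-length-++ : ∀ xs → drop (suc (length xs)) (xs ++ z ∷ ys) ≡ ys
drop-suc-length-++ []       = refl
drop-suc-length-++ (x ∷ xs) = drop-suc-length-++ xs

lookup-length+-++ : ∀ Q → (Q ++ R) ! (length Q + k) ≡ R ! k
lookup-length+-++ []      = refl
lookup-length+-++ (x ∷ Q) = lookup-length+-++ Q

setAt-length+-++ : ∀ Q → setAt (Q ++ R) (length Q + k) x ≡ Q ++ setAt R k x
setAt-length+-++ []      = refl
setAt-length+-++ (y ∷ Q) = cong (y ∷_) (setAt-length+-++ Q)

lookup-split : ∀ w p → w ! p ≡ just x → ∃[ A ] ∃[ B ] (w ≡ A ++ x ∷ B × length A ≡ p)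
lookup-split (y ∷ w) zero    refl = [] , w , refl , refl
lookup-split (y ∷ w) (suc p) e with lookup-split w p e
... | A , B , refl , refl = y ∷ A , B , refl , refl

lookup-split₂ : ∀ {y} w p → w ! p ≡ just x → w ! suc p ≡ just y →
                ∃[ A ] ∃[ B ] (w ≡ A ++ x ∷ y ∷ B × length A ≡ p)
lookup-split₂ (_ ∷ _ ∷ w) zero    refl refl = [] , w , refl , refl
lookup-split₂ (z ∷ w)     (suc p) e₁ e₂ with lookup-split₂ w p e₁ e₂
... | A , B , refl , refl = z ∷ A , B , refl , refl

size≡0⇒¬weight : ∀ {m} w p → size w ≡ 0 → ¬ (w ! p ≡ just (wt m))
size≡0⇒¬weight (⋆ ∷ w)    (suc p) s e = size≡0⇒¬weight w p s e
size≡0⇒¬weight (U ∷ w)    (suc p) s e = size≡0⇒¬weight w p s e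
size≡0⇒¬weight (D ∷ w)    (suc p) s e = size≡0⇒¬weight w p s e
size≡0⇒¬weight (wt _ ∷ w) _       () e

-- Counts are accumulated letter by letter so that they compute on concrete
-- prefixes: countDFrom d (D ∷ Q) = countDFrom (suc d) Q.
addD : Letter → ℕ → ℕ
addD D d = suc d
addD _ d = d

addU : Letter → ℕ → ℕ
addU U u = suc u
addU _ u = u

countDFrom : ℕ → Word → ℕ
countDFrom d []      = d
countDFrom d (x ∷ Q) = countDFrom (addD x d) Q

countUFrom : ℕ → Word → ℕ
countUFrom u []      = u
countUFrom u (x ∷ Q) = countUFrom (addU x u) Q

addD-2+ : ∀ x d → addD x (2 + d) ≡ 2 + addD x d
addD-2+ ⋆      d = refl
addD-2+ U      d = refl
addD-2+ D      d = refl
addD-2+ (wt _) d = refl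

+countD-∷ : ∀ d x T → d + countD (x ∷ T) ≡ addD x d + countD T
+countD-∷ d ⋆      T = refl
+countD-∷ d U      T = refl
+countD-∷ d D      T = +-suc d (countD T)
+countD-∷ d (wt _) T = refl

+countU-∷ : ∀ u x T → u + countU (x ∷ T) ≡ addU x u + countU T
+countU-∷ u ⋆      T = refl
+countU-∷ u U      T = +-suc u (countU T)
+countU-∷ u D      T = refl
+countU-∷ u (wt _) T = refl

+countD-++ : ∀ d Q T → d + countD (Q ++ T) ≡ countDFrom d Q + countD T
+countD-++ d []      T = refl
+countD-++ d (x ∷ Q) T = trans (+countD-∷ d x (Q ++ T)) (+countD-++ (addD x d) Q T)

+countU-++ : ∀ u Q T → u + countU (Q ++ T) ≡ countUFrom u Q + countU T
+countU-++ u []      T = refl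
+countU-++ u (x ∷ Q) T = trans (+countU-∷ u x (Q ++ T)) (+countU-++ (addU x u) Q T)

+countD-take-length+-++ : ∀ d Q R k →
  d + countD (take (length Q + k) (Q ++ R)) ≡ countDFrom d Q + countD (take k R)
+countD-take-length+-++ d Q R k =
  trans (cong (λ P → d + countD P) (take-length+-++ Q)) (+countD-++ d Q (take k R))

+countU-take-length+-++ : ∀ u Q R k →
  u + countU (take (length Q + k) (Q ++ R)) ≡ countUFrom u Q + countU (take k R)
+countU-take-length+-++ u Q R k =
  trans (cong (λ P → u + countU P) (take-length+-++ Q)) (+countU-++ u Q (take k R))

-- Column height in R when R is preceded by d letters D and u letters U;
-- ch k w is chFrom 0 0 w k by computation.
chFrom : ℕ → ℕ → Word → ℕ → ℕ
chFrom d u R k = ⌈ (d + countD (take k R)) ∸ (u + countU (take k R)) /2⌉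

chFrom-++ : ∀ d u Q R k →
  chFrom d u (Q ++ R) (length Q + k) ≡ chFrom (countDFrom d Q) (countUFrom u Q) R k
chFrom-++ d u Q R k = cong₂ (λ p q → ⌈ p ∸ q /2⌉)
  (+countD-take-length+-++ d Q R k) (+countU-take-length+-++ u Q R k)

chFrom-2+ : ∀ d u R k → u + countU (take k R) ≤ d + countD (take k R) →
            chFrom (2 + d) u R k ≡ suc (chFrom d u R k)
chFrom-2+ d u R k u≤d rewrite +-∸-assoc 2 u≤d = refl

suc[⌈m+1∸n/2⌉∸1]≡⌈m+1∸n/2⌉ : ∀ {m n} → n ≤ m → suc (⌈ (m + 1) ∸ n /2⌉ ∸ 1) ≡ ⌈ (m + 1) ∸ n /2⌉
suc[⌈m+1∸n/2⌉∸1]≡⌈m+1∸n/2⌉ {m} {n} n≤m rewrite +-comm m 1 | +-∸-assoc 1 n≤m = refl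

DyckFrom : ℕ → ℕ → Word → Set
DyckFrom d u R = ∀ k → u + countU (take k R) ≤ d + countD (take k R)

BoundedFrom : ℕ → ℕ → Word → Set
BoundedFrom d u R = ∀ k m → R ! k ≡ just (wt m) → m < chFrom d u R k

dyckFrom-++ : ∀ d u Q → DyckFrom d u (Q ++ R) → DyckFrom (countDFrom d Q) (countUFrom u Q) R
dyckFrom-++ {R} d u Q dy k = subst₂ _≤_
  (+countU-take-length+-++ u Q R k) (+countD-take-length+-++ d Q R k) (dy (length Q + k))

boundedFrom-++ : ∀ d u Q → BoundedFrom d u (Q ++ R) → BoundedFrom (countDFrom d Q) (countUFrom u Q) R
boundedFrom-++ {R} d u Q bd k m e =
  subst (m <_) (chFrom-++ d u Q R k) (bd (length Q + k) m (trans (lookup-length+-++ Q) e))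

record EligibleFrom (d u : ℕ) (R : Word) (k : ℕ) : Set where
  constructor eligibleFrom
  field
    weight    : ℕ
    D-at      : R ! k ≡ just D
    weight-at : R ! suc k ≡ just (wt weight)
    maximal   : suc weight ≡ chFrom d u R (suc k)

eligible⇒eligibleFrom : ∀ {w j} → Eligible w j → ∃[ i ] (j ≡ suc i × EligibleFrom 0 0 w i)
eligible⇒eligibleFrom ((m , wt-at , max) , i , refl , D-at) = i , refl , eligibleFrom m D-at wt-at max

eligibleFrom⇒eligible : ∀ {w} → EligibleFrom 0 0 w i → Eligible w (suc i)
eligibleFrom⇒eligible (eligibleFrom m D-at wt-at max) = (m , wt-at , max) , _ , refl , D-at

eligibleFrom-∷⁻ : EligibleFrom d u (x ∷ R) (suc k) → EligibleFrom (addD x d) (addU x u) R k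
eligibleFrom-∷⁻ {d} {u} {x} {R} {k} (eligibleFrom m D-at wt-at max) =
  eligibleFrom m D-at wt-at (trans max (chFrom-++ d u (x ∷ []) R (suc k)))

eligibleFrom-∷⁺ : EligibleFrom (addD x d) (addU x u) R k → EligibleFrom d u (x ∷ R) (suc k)
eligibleFrom-∷⁺ {x} {d} {u} {R} {k} (eligibleFrom m D-at wt-at max) =
  eligibleFrom m D-at wt-at (trans max (sym (chFrom-++ d u (x ∷ []) R (suc k))))

eligibleFrom-suc-suc⁻ : EligibleFrom (suc d) (suc u) R k → EligibleFrom d u R k
eligibleFrom-suc-suc⁻ (eligibleFrom m D-at wt-at max) = eligibleFrom m D-at wt-at max

eligibleFrom-++⁺ : ∀ Q → EligibleFrom (countDFrom d Q) (countUFrom u Q) R k →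
                   EligibleFrom d u (Q ++ R) (length Q + k)
eligibleFrom-++⁺ []      e = e
eligibleFrom-++⁺ (x ∷ Q) e = eligibleFrom-∷⁺ (eligibleFrom-++⁺ Q e)

eligibleFrom-++⁻ : ∀ Q → EligibleFrom d u (Q ++ R) i →
  i < length Q ⊎ ∃[ k ] (i ≡ length Q + k × EligibleFrom (countDFrom d Q) (countUFrom u Q) R k)
eligibleFrom-++⁻ {i = i}     []      e = inj₂ (i , refl , e)
eligibleFrom-++⁻ {i = zero}  (x ∷ Q) e = inj₁ (s≤s z≤n)
eligibleFrom-++⁻ {i = suc i} (x ∷ Q) e with eligibleFrom-++⁻ Q (eligibleFrom-∷⁻ e)
... | inj₁ i<Q              = inj₁ (s≤s i<Q)
... | inj₂ (k , refl , e′) = inj₂ (k , refl , e′)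

-- A weight of B₁ lifted by two letters D has column height one more than
-- before, so it cannot become maximal.
ribbon-eligibleFrom : ∀ d u B₁ n B₂ k →
  DyckFrom d u (B₁ ++ D ∷ wt n ∷ B₂) → BoundedFrom d u (B₁ ++ D ∷ wt n ∷ B₂) →
  EligibleFrom (2 + d) u (B₁ ++ U ∷ wt n ∷ B₂) k →
  length B₁ < k × EligibleFrom d u (B₁ ++ D ∷ wt n ∷ B₂) k
ribbon-eligibleFrom d u [] n B₂ zero          dy bd (eligibleFrom _ () _ _)
ribbon-eligibleFrom d u [] n B₂ (suc zero)    dy bd (eligibleFrom _ () _ _)
ribbon-eligibleFrom d u [] n B₂ (suc (suc k)) dy bd e =
  s≤s z≤n ,
  eligibleFrom-∷⁺ (eligibleFrom-∷⁺ (eligibleFrom-suc-suc⁻ (eligibleFrom-∷⁻ (eligibleFrom-∷⁻ e))))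
ribbon-eligibleFrom d u (x ∷ [])     n B₂ zero dy bd (eligibleFrom _ _ () _)
ribbon-eligibleFrom d u (x ∷ y ∷ B₁) n B₂ zero dy bd (eligibleFrom m refl refl max) =
  ⊥-elim (<-irrefl
    (suc-injective (trans max (chFrom-2+ d u (D ∷ wt m ∷ B₁ ++ D ∷ wt n ∷ B₂) 1 (dy 1))))
    (bd 1 m refl))
ribbon-eligibleFrom d u (x ∷ B₁) n B₂ (suc k) dy bd e =
  map s≤s eligibleFrom-∷⁺
    (ribbon-eligibleFrom (addD x d) (addU x u) B₁ n B₂ k
      (dyckFrom-++ d u (x ∷ []) dy) (boundedFrom-++ d u (x ∷ []) bd)
      (subst (λ d′ → EligibleFrom d′ _ _ k) (addD-2+ x d) (eligibleFrom-∷⁻ e)))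

module _ (A B : Word) where

  newWeight-++ : newWeight (A ++ ⋆ ∷ B) (length A)
               ≡ chFrom (countDFrom 0 A) (countUFrom 0 A) (⋆ ∷ D ∷ []) 2 ∸ 1
  newWeight-++ = trans
    (cong (λ P → ch (length A + 2) (P ++ ⋆ ∷ D ∷ []) ∸ 1) take-length-++)
    (cong (_∸ 1) (chFrom-++ 0 0 A (⋆ ∷ D ∷ []) 2))

  newWeight-eligible : ∀ T → DyckFrom 0 0 (A ++ ⋆ ∷ B) →
    Eligible (A ++ ⋆ ∷ D ∷ wt (newWeight (A ++ ⋆ ∷ B) (length A)) ∷ T) (length A + 2)
  newWeight-eligible T dy =
    (m , lookup-length+-++ A , maximal) , length A + 1 , +-suc (length A) 1 , lookup-length+-++ A
    where
    open ≡-Reasoning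
    m a b : ℕ
    m = newWeight (A ++ ⋆ ∷ B) (length A)
    a = countDFrom 0 A
    b = countUFrom 0 A
    b≤a : b + 0 ≤ a
    b≤a = subst (b + 0 ≤_) (+-identityʳ a) (dyckFrom-++ 0 0 A dy 0)
    maximal : suc m ≡ ch (length A + 2) (A ++ ⋆ ∷ D ∷ wt m ∷ T)
    maximal = begin
      suc m                             ≡⟨ cong suc newWeight-++ ⟩
      suc (⌈ (a + 1) ∸ (b + 0) /2⌉ ∸ 1) ≡⟨ suc[⌈m+1∸n/2⌉∸1]≡⌈m+1∸n/2⌉ b≤a ⟩
      ⌈ (a + 1) ∸ (b + 0) /2⌉           ≡⟨ chFrom-++ 0 0 A (⋆ ∷ D ∷ wt m ∷ T) 2 ⟨
      ch (length A + 2) (A ++ ⋆ ∷ D ∷ wt m ∷ T) ∎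

  columnAdd-++ : columnAdd (A ++ ⋆ ∷ B) (length A)
               ≡ A ++ ⋆ ∷ D ∷ wt (newWeight (A ++ ⋆ ∷ B) (length A)) ∷ U ∷ ⋆ ∷ B
  columnAdd-++ = cong₂ (λ P S → P ++ ⋆ ∷ D ∷ wt (newWeight (A ++ ⋆ ∷ B) (length A)) ∷ U ∷ ⋆ ∷ S)
    take-length-++ (drop-suc-length-++ A)

newWeight-rightmost : ∀ A m T →
  (∀ k → ¬ EligibleFrom (suc (countDFrom 0 A)) (countUFrom 0 A) T k) →
  ∀ j → Eligible (A ++ ⋆ ∷ D ∷ wt m ∷ T) j → j ≤ length A + 2
newWeight-rightmost A m T none j el with eligible⇒eligibleFrom el
... | i , refl , e with eligibleFrom-++⁻ A e
... | inj₁ i<A                             = ≤-trans i<A (m≤m+n (length A) 2)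
... | inj₂ (0 , refl , eligibleFrom _ () _ _)
... | inj₂ (1 , refl , _)                  = ≤-reflexive (sym (+-suc (length A) 1))
... | inj₂ (2 , refl , eligibleFrom _ () _ _)
... | inj₂ (suc (suc (suc k)) , refl , e′) =
  ⊥-elim (none k (eligibleFrom-∷⁻ (eligibleFrom-∷⁻ (eligibleFrom-∷⁻ e′))))

column-special : ∀ A B → DyckFrom 0 0 (A ++ ⋆ ∷ B) →
  (∀ j → Eligible (A ++ ⋆ ∷ B) j → j ≤ length A) →
  IsSpecial (columnAdd (A ++ ⋆ ∷ B) (length A)) (length A + 2)
column-special A B dy left rewrite columnAdd-++ A B =
  newWeight-eligible A B _ dy , newWeight-rightmost A _ _ none
  where
  none : ∀ k → ¬ EligibleFrom (suc (countDFrom 0 A)) (countUFrom 0 A) (U ∷ ⋆ ∷ B) k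
  none zero    (eligibleFrom _ () _ _)
  none (suc k) e = <-irrefl refl (≤-trans (s≤s (m≤m+n (length A) k)) (left _
    (eligibleFrom⇒eligible (eligibleFrom-++⁺ A (eligibleFrom-suc-suc⁻ (eligibleFrom-∷⁻ e))))))

ribbonAdd-columnAdd-++ : ∀ A B₁ n B₂ → let w = A ++ ⋆ ∷ B₁ ++ D ∷ wt n ∷ B₂ in
  ribbonAdd (columnAdd w (length A)) (length A + 3) (suc (length A + suc (length B₁)) + 3)
  ≡ A ++ ⋆ ∷ D ∷ wt (newWeight w (length A)) ∷ D ∷ ⋆ ∷ B₁ ++ U ∷ wt n ∷ B₂
ribbonAdd-columnAdd-++ A B₁ n B₂ = begin
  setAt (setAt (columnAdd w L) (L + 3) D) s′ U
    ≡⟨ cong (λ v → setAt (setAt v (L + 3) D) s′ U) (columnAdd-++ A B) ⟩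
  setAt (setAt (A ++ ⋆ ∷ D ∷ wt m ∷ U ∷ ⋆ ∷ B) (L + 3) D) s′ U
    ≡⟨ cong (λ v → setAt v s′ U) (setAt-length+-++ A) ⟩
  setAt (A ++ ⋆ ∷ D ∷ wt m ∷ D ∷ ⋆ ∷ B) s′ U
    ≡⟨ cong (λ i → setAt (A ++ ⋆ ∷ D ∷ wt m ∷ D ∷ ⋆ ∷ B) i U) (position L (length B₁)) ⟩
  setAt (A ++ ⋆ ∷ D ∷ wt m ∷ D ∷ ⋆ ∷ B) (L + (5 + (length B₁ + 0))) U
    ≡⟨ setAt-length+-++ A ⟩
  A ++ ⋆ ∷ D ∷ wt m ∷ D ∷ ⋆ ∷ setAt B (length B₁ + 0) U
    ≡⟨ cong (λ S → A ++ ⋆ ∷ D ∷ wt m ∷ D ∷ ⋆ ∷ S) (setAt-length+-++ B₁) ⟩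
  A ++ ⋆ ∷ D ∷ wt m ∷ D ∷ ⋆ ∷ B₁ ++ U ∷ wt n ∷ B₂ ∎
  where
  open ≡-Reasoning
  B w : Word
  B = B₁ ++ D ∷ wt n ∷ B₂
  w = A ++ ⋆ ∷ B
  L m s′ : ℕ
  L = length A
  m = newWeight w L
  s′ = suc (L + suc (length B₁)) + 3
  position : ∀ l b → suc (l + suc b) + 3 ≡ l + (5 + (b + 0))
  position = solve-∀

ribbon-special : ∀ A B₁ n B₂ → let w = A ++ ⋆ ∷ B₁ ++ D ∷ wt n ∷ B₂ in
  WeightedDyck w → (∀ j → Eligible w j → j ≤ suc (length A + suc (length B₁))) →
  IsSpecial (ribbonAdd (columnAdd w (length A)) (length A + 3) (suc (length A + suc (length B₁)) + 3))
            (length A + 2)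
ribbon-special A B₁ n B₂ wd left rewrite ribbonAdd-columnAdd-++ A B₁ n B₂ =
  newWeight-eligible A B _ dy , newWeight-rightmost A _ _ none
  where
  B : Word
  B = B₁ ++ D ∷ wt n ∷ B₂
  a b : ℕ
  a = countDFrom 0 A
  b = countUFrom 0 A
  dy : DyckFrom 0 0 (A ++ ⋆ ∷ B)
  dy = proj₁ (WeightedDyck.dyck wd)
  none : ∀ k → ¬ EligibleFrom (suc a) b (D ∷ ⋆ ∷ B₁ ++ U ∷ wt n ∷ B₂) k
  none zero             (eligibleFrom _ _ () _)
  none (suc zero)       (eligibleFrom _ () _ _)
  none (suc (suc k)) e with ribbon-eligibleFrom a b B₁ n B₂ k
      (dyckFrom-++ a b (⋆ ∷ []) (dyckFrom-++ 0 0 A dy))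
      (boundedFrom-++ a b (⋆ ∷ []) (boundedFrom-++ 0 0 A (WeightedDyck.bounded wd)))
      (eligibleFrom-∷⁻ (eligibleFrom-∷⁻ e))
  ... | B₁<k , e′ = <⇒≱ B₁<k (s≤s⁻¹ (+-cancelˡ-≤ (length A) _ _ (s≤s⁻¹ (left _
          (eligibleFrom⇒eligible (eligibleFrom-++⁺ A (eligibleFrom-∷⁺ e′)))))))

special-split : ∀ A B s → Eligible (A ++ ⋆ ∷ B) s → length A < s →
  ∃[ B₁ ] ∃[ n ] ∃[ B₂ ] (B ≡ B₁ ++ D ∷ wt n ∷ B₂ × s ≡ suc (length A + suc (length B₁)))
special-split A B s el A<s with eligible⇒eligibleFrom el
... | i , refl , e with eligibleFrom-++⁻ A e
... | inj₁ i<A = ⊥-elim (<⇒≱ i<A (s≤s⁻¹ A<s))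
... | inj₂ (zero  , refl , eligibleFrom _ () _ _)
... | inj₂ (suc k , refl , e′) with eligibleFrom-∷⁻ e′
... | eligibleFrom n D-at wt-at _ with lookup-split₂ B k D-at wt-at
... | B₁ , B₂ , refl , refl = B₁ , n , B₂ , refl , refl

insert-special : ∀ A B → WeightedDyck (A ++ ⋆ ∷ B) → (ms : Maybe ℕ) → SpecialOf (A ++ ⋆ ∷ B) ms →
  IsSpecial (insert (A ++ ⋆ ∷ B) (length A) ms) (length A + 2)
insert-special A B wd nothing size≡0 = column-special A B (proj₁ (WeightedDyck.dyck wd))
  λ j ((_ , wt-at , _) , _) → ⊥-elim (size≡0⇒¬weight (A ++ ⋆ ∷ B) j size≡0 wt-at)
insert-special A B wd (just s) (s-eligible , s-rightmost) with length A <? s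
... | no ¬A<s = column-special A B (proj₁ (WeightedDyck.dyck wd))
  λ j el → ≤-trans (s-rightmost j el) (≮⇒≥ ¬A<s)
... | yes A<s with special-split A B s s-eligible A<s
... | B₁ , n , B₂ , refl , refl = ribbon-special A B₁ n B₂ wd s-rightmost

proposition4 : (w : Word) → WeightedDyck w → (p : ℕ) → w ! p ≡ just ⋆ →
    (ms : Maybe ℕ) → SpecialOf w ms → IsSpecial (insert w p ms) (p + 2)
proposition4 w wd p w!p≡⋆ ms sp with lookup-split w p w!p≡⋆
... | A , B , refl , refl = insert-special A B wd ms sp
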